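{- Let $j\ge1$ and $\gamma\ge2$ be integers with $j+\gamma\le n$, and let $g\in\mathbb{C}[x_1,\ldots,x_n]$ satisfy $\overline{\partial}_{j+1}(g)=\cdots=\overline{\partial}_{j+\gamma-1}(g)=g$ and $\partial_{j+1}(g)=\cdots=\partial_{j+\gamma-1}(g)=0$. Then \[\overline{\partial}_{j+\gamma-1}\cdots\overline{\partial}_{j+1}\overline{\partial}_j(x_j^\gamma g)=\overline{\pi}_{j+\gamma-1}\cdots\overline{\pi}_{j+1}\overline{\pi}_j(g).\]
   Context: For $k\in[n-1]$: $\partial_k(f)=\frac{f-s_kf}{x_k-x_{k+1}}$ where $s_kf$ is $f$ with $x_k,x_{k+1}$ swapped; $\overline{\partial}_k(f)=\partial_k((1-x_{k+1})f)$; $\overline{\pi}_k(f)=\partial_k(x_k(1-x_{k+1})f)$. The condition $j+\gamma\le n$ only ensures all operators involved are defined. -}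

module Defs where

open import Level using (_⊔_)
open import Algebra.Bundles using (CommutativeRing)
open import Data.Nat as ℕ using (ℕ; zero; suc)
open import Data.Vec as Vec using (Vec; []; _∷_; replicate; zipWith)
open import Data.Vec.Properties using (≡-dec)
open import Data.List as List using (List; []; _∷_; _++_; map; concatMap)
open import Data.Product using (Σ; _×_; _,_)
open import Relation.Nullary using (yes; no)

-- Multivariate polynomials in n variables x₁,…,xₙ over a commutative ring R,
-- represented as finite lists of terms (coefficient , exponent vector).
-- Variables are indexed 1-based by natural numbers, as in the paper:
-- variable x_i sits at position i-1 of the exponent vector.

-- swap the entries at 0-based positions i and i+1
swapAt : ∀ {a} {A : Set a} {n} → ℕ → Vec A n → Vec A n
swapAt zero    (a ∷ b ∷ v) = b ∷ a ∷ v
swapAt zero    v           = v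
swapAt (suc i) []          = []
swapAt (suc i) (a ∷ v)     = a ∷ swapAt i v

-- exponent vector with e at 0-based position i (zero vector if out of range)
unitExp : ∀ {n} → ℕ → ℕ → Vec ℕ n
unitExp {zero}  _       _ = []
unitExp {suc n} zero    e = e ∷ replicate n 0
unitExp {suc n} (suc i) e = 0 ∷ unitExp i e

module Poly {c ℓ} (R : CommutativeRing c ℓ) where
  open CommutativeRing R renaming (Carrier to A; _+_ to _+ᴿ_; _*_ to _*ᴿ_; -_ to -ᴿ_; 0# to 0ᴿ; 1# to 1ᴿ)

  Pol : ℕ → Set c
  Pol n = List (A × Vec ℕ n)

  module _ {n : ℕ} where
    coeff : Pol n → Vec ℕ n → A
    coeff []             m = 0ᴿ
    coeff ((a , e) ∷ p) m with ≡-dec ℕ._≟_ e m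
    ... | yes _ = a +ᴿ coeff p m
    ... | no  _ = coeff p m

    infix 4 _≋_
    _≋_ : Pol n → Pol n → Set ℓ
    p ≋ q = ∀ m → coeff p m ≈ coeff q m

    0P : Pol n
    0P = []

    1P : Pol n
    1P = (1ᴿ , replicate n 0) ∷ []

    xPow : ℕ → ℕ → Pol n
    xPow i e = (1ᴿ , unitExp (i ℕ.∸ 1) e) ∷ []

    x : ℕ → Pol n
    x i = xPow i 1

    infixl 6 _+P_ _-P_
    infixl 7 _*P_
    _+P_ : Pol n → Pol n → Pol n
    _+P_ = _++_

    -P_ : Pol n → Pol n
    -P_ = map (λ { (a , e) → (-ᴿ a , e) })

    _-P_ : Pol n → Pol n → Pol n
    p -P q = p +P (-P q)

    _*P_ : Pol n → Pol n → Pol n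
    p *P q = concatMap (λ { (a , e) → map (λ { (b , f) → (a *ᴿ b , zipWith ℕ._+_ e f) }) q }) p

    s : ℕ → Pol n → Pol n
    s k = map (λ { (a , e) → (a , swapAt (k ℕ.∸ 1) e) })

    -- IsDD k f h  :  h = ∂_k(f) = (f - s_k f)/(x_k - x_{k+1}),
    -- i.e. h is the (unique) quotient: (x_k - x_{k+1}) h = f - s_k f.
    IsDD : ℕ → Pol n → Pol n → Set ℓ
    IsDD k f h = (x k -P x (suc k)) *P h ≋ f -P s k f

    IsDDbar : ℕ → Pol n → Pol n → Set ℓ
    IsDDbar k f h = IsDD k ((1P -P x (suc k)) *P f) h

    IsPibar : ℕ → Pol n → Pol n → Set ℓ
    IsPibar k f h = IsDD k (x k *P ((1P -P x (suc k)) *P f)) h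

    ChainBar : ℕ → ℕ → Pol n → Pol n → Set (c ⊔ ℓ)
    ChainBar k zero    f h = Level.Lift c (f ≋ h)
    ChainBar k (suc m) f h = Σ (Pol n) λ p → IsDDbar k f p × ChainBar (suc k) m p h

    ChainPi : ℕ → ℕ → Pol n → Pol n → Set (c ⊔ ℓ)
    ChainPi k zero    f h = Level.Lift c (f ≋ h)
    ChainPi k (suc m) f h = Σ (Pol n) λ p → IsPibar k f p × ChainPi (suc k) m p h

{-# OPTIONS --safe #-}
-- Write x̄ = 1 − x, so that ∂̄ₖ f = ∂ₖ(x̄ₖ₊₁ f) and π̄ₖ g = ∂̄ₖ(xₖ g). The twisted Leibniz rule
-- ∂ₖ(u v) = ∂ₖ(u) v + sₖ(u) ∂ₖ(v) gives ∂̄ₖ(xₖᶜ F) = xₖ₊₁ᶜ ∂̄ₖ(F) + E, where E is a sum of terms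
-- xₖ₊₁ᵇ x̄ₖ₊₁ S with b < c and S invariant under the later transpositions sₖ₊₁, sₖ₊₂, …
-- A chain of r operators ∂̄ starting at k kills every xₖᵇ x̄ₖ S with b < r: since ∂̄ₖ(x̄ₖ S) = 0, its
-- first step leaves only terms of the same shape for a chain of r − 1 operators. Taking F = xⱼ g,
-- the first step therefore turns xⱼ^γ g into xⱼ₊₁^{γ−1} π̄ⱼ(g) modulo killed terms, and π̄ⱼ(g)
-- inherits the symmetry of g under sⱼ₊₂, …, so induction on γ concludes. Besides ring identities,
-- the argument only uses that the sₖ are ring endomorphisms permuting the variables and that
-- xₖ − xₖ₊₁ is not a zero divisor, which makes divided differences unique.
module Submission where

open import Defs
open import Algebra.Bundles using (CommutativeRing)
open import Data.Nat as ℕ using (ℕ; zero; suc; _≤_; _<_)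
open import Data.Product using (_,_)

module Exponent where

  open import Data.Nat using (_+_; s≤s)
  open import Data.Nat.Properties using (+-comm; +-assoc; +-identityˡ; +-identityʳ; +-suc)
  open import Data.Vec using (Vec; []; _∷_; replicate; zipWith)
  open import Data.Vec.Properties using (zipWith-comm; zipWith-assoc; zipWith-identityˡ)
  open import Data.Maybe as Maybe using (Maybe; just; nothing)
  open import Relation.Binary.PropositionalEquality using (_≡_; refl; cong; cong₂; sym; trans; module ≡-Reasoning)

  infixl 6 _⊕_
  _⊕_ : ∀ {n} → Vec ℕ n → Vec ℕ n → Vec ℕ n
  _⊕_ = zipWith _+_

  ⊕-comm : ∀ {n} (u v : Vec ℕ n) → u ⊕ v ≡ v ⊕ u
  ⊕-comm = zipWith-comm +-comm

  ⊕-assoc : ∀ {n} (u v w : Vec ℕ n) → (u ⊕ v) ⊕ w ≡ u ⊕ (v ⊕ w)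
  ⊕-assoc = zipWith-assoc +-assoc

  ⊕-identityˡ : ∀ {n} (u : Vec ℕ n) → replicate n 0 ⊕ u ≡ u
  ⊕-identityˡ = zipWith-identityˡ +-identityˡ

  _∸?_ : ℕ → ℕ → Maybe ℕ
  m     ∸? zero  = just m
  zero  ∸? suc f = nothing
  suc m ∸? suc f = m ∸? f

  +-∸? : ∀ e f → (e + f) ∸? f ≡ just e
  +-∸? e zero    = cong just (+-identityʳ e)
  +-∸? e (suc f) = trans (cong (_∸? suc f) (+-suc e f)) (+-∸? e f)

  ∸?-complete : ∀ m f {e} → m ∸? f ≡ just e → e + f ≡ m
  ∸?-complete m       zero    refl = +-identityʳ m
  ∸?-complete (suc m) (suc f) eq   = trans (+-suc _ f) (cong suc (∸?-complete m f eq))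

  _⊖_ : ∀ {n} → Vec ℕ n → Vec ℕ n → Maybe (Vec ℕ n)
  []       ⊖ []       = just []
  (m ∷ ms) ⊖ (f ∷ fs) = Maybe.zipWith _∷_ (m ∸? f) (ms ⊖ fs)

  ⊕-⊖ : ∀ {n} (e f : Vec ℕ n) → (e ⊕ f) ⊖ f ≡ just e
  ⊕-⊖ []       []       = refl
  ⊕-⊖ (e ∷ es) (f ∷ fs) rewrite +-∸? e f | ⊕-⊖ es fs = refl

  ⊖-sound : ∀ {n} {e f m : Vec ℕ n} → e ⊕ f ≡ m → m ⊖ f ≡ just e
  ⊖-sound {e = e} {f} refl = ⊕-⊖ e f

  ⊖-complete : ∀ {n} (m f : Vec ℕ n) {e} → m ⊖ f ≡ just e → e ⊕ f ≡ m
  ⊖-complete [] [] refl = refl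
  ⊖-complete (m ∷ ms) (f ∷ fs) eq with m ∸? f in p | ms ⊖ fs in q
  ... | just _  | just _ with refl ← eq = cong₂ _∷_ (∸?-complete m f p) (⊖-complete ms fs q)
  ... | just _  | nothing with () ← eq
  ... | nothing | _       with () ← eq

  module _ {a} {A : Set a} where

    swapAt-involutive : ∀ {n} i (v : Vec A n) → swapAt i (swapAt i v) ≡ v
    swapAt-involutive zero    []          = refl
    swapAt-involutive zero    (a ∷ [])    = refl
    swapAt-involutive zero    (a ∷ b ∷ v) = refl
    swapAt-involutive (suc i) []          = refl
    swapAt-involutive (suc i) (a ∷ v)     = cong (a ∷_) (swapAt-involutive i v)

    swapAt-replicate : ∀ {n} i (a : A) → swapAt i (replicate n a) ≡ replicate n a
    swapAt-replicate {zero}        zero    a = refl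
    swapAt-replicate {suc zero}    zero    a = refl
    swapAt-replicate {suc (suc n)} zero    a = refl
    swapAt-replicate {zero}        (suc i) a = refl
    swapAt-replicate {suc n}       (suc i) a = cong (a ∷_) (swapAt-replicate i a)

    swapAt-comm : ∀ {n} i l (v : Vec A n) → suc (suc i) ≤ l →
                  swapAt i (swapAt l v) ≡ swapAt l (swapAt i v)
    swapAt-comm zero    (suc (suc l)) []          _         = refl
    swapAt-comm zero    (suc (suc l)) (a ∷ [])    _         = refl
    swapAt-comm zero    (suc (suc l)) (a ∷ b ∷ v) _         = refl
    swapAt-comm zero    (suc zero)    v           (s≤s ())
    swapAt-comm (suc i) (suc l)       []          _         = refl
    swapAt-comm (suc i) (suc l)       (a ∷ v)     (s≤s i<l) = cong (a ∷_) (swapAt-comm i l v i<l)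

  swapAt-⊕ : ∀ {n} i (u v : Vec ℕ n) → swapAt i (u ⊕ v) ≡ swapAt i u ⊕ swapAt i v
  swapAt-⊕ zero    []           []           = refl
  swapAt-⊕ zero    (a ∷ [])     (b ∷ [])     = refl
  swapAt-⊕ zero    (a ∷ a′ ∷ u) (b ∷ b′ ∷ v) = refl
  swapAt-⊕ (suc i) []           []           = refl
  swapAt-⊕ (suc i) (a ∷ u)      (b ∷ v)      = cong (a + b ∷_) (swapAt-⊕ i u v)

  swapAt-unitExp : ∀ {n} i e → suc i < n → swapAt i (unitExp {n} i e) ≡ unitExp (suc i) e
  swapAt-unitExp {suc (suc n)} zero    e _         = refl
  swapAt-unitExp {suc n}       (suc i) e (s≤s i<n) = cong (0 ∷_) (swapAt-unitExp i e i<n)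

  swapAt-unitExp-suc : ∀ {n} i e → suc i < n → swapAt i (unitExp {n} (suc i) e) ≡ unitExp i e
  swapAt-unitExp-suc i e i<n =
    trans (cong (swapAt i) (sym (swapAt-unitExp i e i<n))) (swapAt-involutive i _)

  swapAt-unitExp-< : ∀ {n} i l e → l < i → swapAt i (unitExp {n} l e) ≡ unitExp l e
  swapAt-unitExp-< {zero}  (suc i) l       e _         = refl
  swapAt-unitExp-< {suc n} (suc i) zero    e _         = cong (e ∷_) (swapAt-replicate i 0)
  swapAt-unitExp-< {suc n} (suc i) (suc l) e (s≤s l<i) = cong (0 ∷_) (swapAt-unitExp-< i l e l<i)

  unitExp-zero : ∀ {n} l → unitExp {n} l 0 ≡ replicate n 0
  unitExp-zero {zero}  l       = refl
  unitExp-zero {suc n} zero    = refl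
  unitExp-zero {suc n} (suc l) = cong (0 ∷_) (unitExp-zero l)

  unitExp-⊕ : ∀ {n} l a b → unitExp {n} l a ⊕ unitExp l b ≡ unitExp l (a + b)
  unitExp-⊕ {zero}  l       a b = refl
  unitExp-⊕ {suc n} zero    a b = cong (a + b ∷_) (⊕-identityˡ (replicate n 0))
  unitExp-⊕ {suc n} (suc l) a b = cong (0 ∷_) (unitExp-⊕ l a b)

  entry : ∀ {n} → ℕ → Vec ℕ n → ℕ
  entry i       []      = 0
  entry zero    (a ∷ v) = a
  entry (suc i) (a ∷ v) = entry i v

  entry-⊕ : ∀ {n} i (u v : Vec ℕ n) → entry i (u ⊕ v) ≡ entry i u + entry i v
  entry-⊕ i       []      []      = refl
  entry-⊕ zero    (a ∷ u) (b ∷ v) = refl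
  entry-⊕ (suc i) (a ∷ u) (b ∷ v) = entry-⊕ i u v

  entry-replicate : ∀ {n} i → entry i (replicate n 0) ≡ 0
  entry-replicate {zero}  i       = refl
  entry-replicate {suc n} zero    = refl
  entry-replicate {suc n} (suc i) = entry-replicate {n} i

  entry-unitExp : ∀ {n} i e → i < n → entry i (unitExp {n} i e) ≡ e
  entry-unitExp {suc n} zero    e _         = refl
  entry-unitExp {suc n} (suc i) e (s≤s i<n) = entry-unitExp i e i<n

  entry-unitExp-pred : ∀ {n} i e → entry (suc i) (unitExp {n} i e) ≡ 0
  entry-unitExp-pred {zero}  i       e = refl
  entry-unitExp-pred {suc n} zero    e = entry-replicate {n} 0
  entry-unitExp-pred {suc n} (suc i) e = entry-unitExp-pred {n} i e

  entry-transfer : ∀ {n} k (d d′ : Vec ℕ n) → suc k < n →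
                   d′ ⊕ unitExp (suc k) 1 ≡ d ⊕ unitExp k 1 → suc (entry (suc k) d′) ≡ entry (suc k) d
  entry-transfer {n} k d d′ k<n eq = begin
    suc (entry (suc k) d′)                         ≡⟨ +-comm 1 _ ⟩
    entry (suc k) d′ + 1                           ≡⟨ cong (entry (suc k) d′ +_) (entry-unitExp (suc k) 1 k<n) ⟨
    entry (suc k) d′ + entry (suc k) (unitExp {n} (suc k) 1) ≡⟨ entry-⊕ (suc k) d′ _ ⟨
    entry (suc k) (d′ ⊕ unitExp (suc k) 1)         ≡⟨ cong (entry (suc k)) eq ⟩
    entry (suc k) (d ⊕ unitExp k 1)                ≡⟨ entry-⊕ (suc k) d _ ⟩
    entry (suc k) d + entry (suc k) (unitExp {n} k 1) ≡⟨ cong (entry (suc k) d +_) (entry-unitExp-pred {n} k 1) ⟩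
    entry (suc k) d + 0                            ≡⟨ +-identityʳ _ ⟩
    entry (suc k) d                                ∎
    where open ≡-Reasoning

module PolynomialRing {c ℓ} (R : CommutativeRing c ℓ) (n : ℕ) where

  open import Data.Nat using (_∸_; s≤s)
  open import Data.Nat.Properties using (suc-injective)
  open import Data.Vec using (Vec; replicate)
  open import Data.Vec.Properties using (≡-dec)
  open import Data.List using (List; []; _∷_; _++_; map; concatMap)
  open import Data.List.Properties using (++-assoc; map-++)
  open import Data.Product using (_,_; proj₁; proj₂)
  open import Data.Maybe using (Maybe; just; nothing)
  open import Data.Maybe.Properties using (just-injective)
  open import Data.Empty using (⊥-elim)
  open import Relation.Nullary using (Dec; yes; no)
  open import Relation.Binary.PropositionalEquality as ≡ using (_≡_)
  open import Algebra.Structures using (IsCommutativeRing)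
  open import Algebra.Consequences.Setoid using (comm∧idˡ⇒id; comm∧invˡ⇒inv; comm∧distrˡ⇒distr)
  open import Relation.Binary.Bundles using (Setoid)
  open import Relation.Binary.Structures using (IsEquivalence)
  open import Algebra.Properties.Group using (ε⁻¹≈ε; x∙y⁻¹≈ε⇒x≈y)
  open import Algebra.Properties.Ring using ([y-z]x≈yx-zx)
  open import Algebra.Properties.AbelianGroup using (⁻¹-∙-comm)
  open import Algebra.Properties.CommutativeSemigroup using (interchange)

  open Exponent

  open CommutativeRing R renaming (Carrier to A)
  open Poly R
  open import Relation.Binary.Reasoning.Setoid setoid

  Exp : Set
  Exp = Vec ℕ n

  ∑ : ∀ {b} {B : Set b} → (B → A) → List B → A
  ∑ φ []      = 0#
  ∑ φ (t ∷ p) = φ t + ∑ φ p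

  module _ {b} {B : Set b} where

    ∑-++ : ∀ (φ : B → A) p q → ∑ φ (p ++ q) ≈ ∑ φ p + ∑ φ q
    ∑-++ φ []      q = sym (+-identityˡ _)
    ∑-++ φ (t ∷ p) q = trans (+-congˡ (∑-++ φ p q)) (sym (+-assoc _ _ _))

    ∑-cong : ∀ {φ ψ : B → A} p → (∀ t → φ t ≈ ψ t) → ∑ φ p ≈ ∑ ψ p
    ∑-cong []      φ≈ψ = refl
    ∑-cong (t ∷ p) φ≈ψ = +-cong (φ≈ψ t) (∑-cong p φ≈ψ)

    ∑-zero : ∀ (p : List B) → ∑ (λ _ → 0#) p ≈ 0#
    ∑-zero []      = refl
    ∑-zero (t ∷ p) = trans (+-identityˡ _) (∑-zero p)

    ∑-+ : ∀ (φ ψ : B → A) p → ∑ (λ t → φ t + ψ t) p ≈ ∑ φ p + ∑ ψ p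
    ∑-+ φ ψ []      = sym (+-identityˡ _)
    ∑-+ φ ψ (t ∷ p) = trans (+-congˡ (∑-+ φ ψ p)) (interchange +-commutativeSemigroup _ _ _ _)

    ∑-*ˡ : ∀ a (φ : B → A) p → ∑ (λ t → a * φ t) p ≈ a * ∑ φ p
    ∑-*ˡ a φ []      = sym (zeroʳ a)
    ∑-*ˡ a φ (t ∷ p) = trans (+-congˡ (∑-*ˡ a φ p)) (sym (distribˡ a _ _))

    ∑-map : ∀ {b′} {B′ : Set b′} (φ : B → A) (f : B′ → B) p → ∑ φ (map f p) ≡ ∑ (λ t → φ (f t)) p
    ∑-map φ f []      = ≡.refl
    ∑-map φ f (t ∷ p) = ≡.cong (φ (f t) +_) (∑-map φ f p)

    ∑-concatMap : ∀ {b′} {B′ : Set b′} (φ : B → A) (f : B′ → List B) p →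
                  ∑ φ (concatMap f p) ≈ ∑ (λ t → ∑ φ (f t)) p
    ∑-concatMap φ f []      = refl
    ∑-concatMap φ f (t ∷ p) = trans (∑-++ φ (f t) _) (+-congˡ (∑-concatMap φ f p))

  ∑-comm : ∀ {b b′} {B : Set b} {B′ : Set b′} (φ : B → B′ → A) p q →
           ∑ (λ t → ∑ (φ t) q) p ≈ ∑ (λ u → ∑ (λ t → φ t u) p) q
  ∑-comm φ []      q = sym (∑-zero q)
  ∑-comm φ (t ∷ p) q = trans (+-congˡ (∑-comm φ p q)) (sym (∑-+ (φ t) _ q))

  select : ∀ {p} {P : Set p} → Dec P → A → A
  select (yes _) a = a
  select (no _)  a = 0#

  select-cong : ∀ {p q} {P : Set p} {Q : Set q} (d : Dec P) (d′ : Dec Q) {a b} →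
                (P → Q) → (Q → P) → a ≈ b → select d a ≈ select d′ b
  select-cong (yes p) (yes q) P→Q Q→P a≈b = a≈b
  select-cong (yes p) (no ¬q) P→Q Q→P a≈b = ⊥-elim (¬q (P→Q p))
  select-cong (no ¬p) (yes q) P→Q Q→P a≈b = ⊥-elim (¬p (Q→P q))
  select-cong (no ¬p) (no ¬q) P→Q Q→P a≈b = refl

  select-*ʳ : ∀ {p} {P : Set p} (d : Dec P) a b → select d (a * b) ≈ b * select d a
  select-*ʳ (yes _) a b = *-comm a b
  select-*ʳ (no _)  a b = sym (zeroʳ b)

  select-neg : ∀ {p} {P : Set p} (d : Dec P) a → select d (- a) ≈ - select d a
  select-neg (yes _) a = refl
  select-neg (no _)  a = sym (ε⁻¹≈ε +-group)

  infix 4 _≟ₑ_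
  _≟ₑ_ : (u v : Exp) → Dec (u ≡ v)
  _≟ₑ_ = ≡-dec Data.Nat._≟_

  -- coeff recast as a sum, so that the lemmas about ∑ apply to it
  coeffΣ : Pol n → Exp → A
  coeffΣ p m = ∑ (λ { (a , e) → select (e ≟ₑ m) a }) p

  coeff≈coeffΣ : ∀ p m → coeff p m ≈ coeffΣ p m
  coeff≈coeffΣ []            m = refl
  coeff≈coeffΣ ((a , e) ∷ p) m with e ≟ₑ m
  ... | yes _ = +-congˡ (coeff≈coeffΣ p m)
  ... | no _  = trans (coeff≈coeffΣ p m) (sym (+-identityˡ _))

  ≋⇒coeffΣ : ∀ p q → p ≋ q → ∀ m → coeffΣ p m ≈ coeffΣ q m
  ≋⇒coeffΣ p q p≋q m = trans (sym (coeff≈coeffΣ p m)) (trans (p≋q m) (coeff≈coeffΣ q m))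

  coeffΣ⇒≋ : ∀ p q → (∀ m → coeffΣ p m ≈ coeffΣ q m) → p ≋ q
  coeffΣ⇒≋ p q eq m = trans (coeff≈coeffΣ p m) (trans (eq m) (sym (coeff≈coeffΣ q m)))

  coeffΣ-+P : ∀ p q m → coeffΣ (p +P q) m ≈ coeffΣ p m + coeffΣ q m
  coeffΣ-+P p q m = ∑-++ _ p q

  coeffΣ--P : ∀ p m → coeffΣ (-P p) m ≈ - coeffΣ p m
  coeffΣ--P []            m = sym (ε⁻¹≈ε +-group)
  coeffΣ--P ((a , e) ∷ p) m =
    trans (+-cong (select-neg (e ≟ₑ m) a) (coeffΣ--P p m)) (⁻¹-∙-comm +-abelianGroup _ _)

  convolution : Pol n → Pol n → Exp → A
  convolution p q m = ∑ (λ { (a , e) → ∑ (λ { (b , f) → select (e ⊕ f ≟ₑ m) (a * b) }) q }) p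

  coeffΣ-*P : ∀ p q m → coeffΣ (p *P q) m ≈ convolution p q m
  coeffΣ-*P p q m = trans (∑-concatMap _ _ p) (∑-cong p λ t → reflexive (∑-map _ _ q))

  coeffAt : Pol n → Maybe Exp → A
  coeffAt p nothing  = 0#
  coeffAt p (just d) = coeffΣ p d

  coeffAt-cong : ∀ d p q → p ≋ q → coeffAt p d ≈ coeffAt q d
  coeffAt-cong nothing  p q p≋q = refl
  coeffAt-cong (just d) p q p≋q = ≋⇒coeffΣ p q p≋q d

  ∑-select-⊕ : ∀ p f m → ∑ (λ { (a , e) → select (e ⊕ f ≟ₑ m) a }) p ≈ coeffAt p (m ⊖ f)
  ∑-select-⊕ p f m with m ⊖ f in eq
  ... | nothing = trans (∑-cong p vanish) (∑-zero p)
    where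
    vanish : ∀ t → select (proj₂ t ⊕ f ≟ₑ m) (proj₁ t) ≈ 0#
    vanish (a , e) with e ⊕ f ≟ₑ m
    ... | yes e⊕f≡m with () ← ≡.trans (≡.sym eq) (⊖-sound e⊕f≡m)
    ... | no _ = refl
  ... | just d = ∑-cong p λ { (a , e) → select-cong (e ⊕ f ≟ₑ m) (e ≟ₑ d)
    (λ e⊕f≡m → just-injective (≡.trans (≡.sym (⊖-sound e⊕f≡m)) eq))
    (λ e≡d → ≡.subst (λ e → e ⊕ f ≡ m) (≡.sym e≡d) (⊖-complete m f eq)) refl }

  coeffΣ-*P-⊖ : ∀ p q m → coeffΣ (p *P q) m ≈ ∑ (λ { (b , f) → b * coeffAt p (m ⊖ f) }) q
  coeffΣ-*P-⊖ p q m = begin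
    coeffΣ (p *P q) m ≈⟨ coeffΣ-*P p q m ⟩
    convolution p q m ≈⟨ ∑-comm _ p q ⟩
    _                 ≈⟨ ∑-cong q (λ { (b , f) → begin
      ∑ (λ { (a , e) → select (e ⊕ f ≟ₑ m) (a * b) }) p ≈⟨ ∑-cong p (λ { (a , e) → select-*ʳ (e ⊕ f ≟ₑ m) a b }) ⟩
      ∑ (λ { (a , e) → b * select (e ⊕ f ≟ₑ m) a }) p  ≈⟨ ∑-*ˡ b _ p ⟩
      b * ∑ (λ { (a , e) → select (e ⊕ f ≟ₑ m) a }) p  ≈⟨ *-congˡ (∑-select-⊕ p f m) ⟩
      b * coeffAt p (m ⊖ f)                            ∎ }) ⟩
    ∑ (λ { (b , f) → b * coeffAt p (m ⊖ f) }) q ∎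

  ≋-isEquivalence : IsEquivalence (_≋_ {n})
  ≋-isEquivalence = record
    { refl  = λ m → refl
    ; sym   = λ p≋q m → sym (p≋q m)
    ; trans = λ p≋q q≋r m → trans (p≋q m) (q≋r m)
    }

  ≋-setoid : Setoid c ℓ
  ≋-setoid = record { isEquivalence = ≋-isEquivalence }

  ≡⇒≋ : ∀ {p q : Pol n} → p ≡ q → p ≋ q
  ≡⇒≋ ≡.refl m = refl

  monomial-cong : ∀ {e e′ : Exp} → e ≡ e′ → (1# , e) ∷ [] ≋ (1# , e′) ∷ []
  monomial-cong e≡e′ = ≡⇒≋ (≡.cong (λ e → (1# , e) ∷ []) e≡e′)

  +P-cong : ∀ p p′ q q′ → p ≋ p′ → q ≋ q′ → p +P q ≋ p′ +P q′
  +P-cong p p′ q q′ p≋p′ q≋q′ = coeffΣ⇒≋ (p +P q) (p′ +P q′) λ m → begin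
    coeffΣ (p +P q) m             ≈⟨ coeffΣ-+P p q m ⟩
    coeffΣ p m + coeffΣ q m       ≈⟨ +-cong (≋⇒coeffΣ p p′ p≋p′ m) (≋⇒coeffΣ q q′ q≋q′ m) ⟩
    coeffΣ p′ m + coeffΣ q′ m     ≈⟨ coeffΣ-+P p′ q′ m ⟨
    coeffΣ (p′ +P q′) m           ∎

  +P-comm : ∀ p q → p +P q ≋ q +P p
  +P-comm p q = coeffΣ⇒≋ (p +P q) (q +P p) λ m →
    trans (coeffΣ-+P p q m) (trans (+-comm _ _) (sym (coeffΣ-+P q p m)))

  -P-cong : ∀ p q → p ≋ q → -P p ≋ -P q
  -P-cong p q p≋q = coeffΣ⇒≋ (-P p) (-P q) λ m →
    trans (coeffΣ--P p m) (trans (-‿cong (≋⇒coeffΣ p q p≋q m)) (sym (coeffΣ--P q m)))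

  -P-inverseˡ : ∀ p → (-P p) +P p ≋ 0P
  -P-inverseˡ p = coeffΣ⇒≋ ((-P p) +P p) 0P λ m →
    trans (coeffΣ-+P (-P p) p m) (trans (+-congʳ (coeffΣ--P p m)) (-‿inverseˡ _))

  *P-congʳ : ∀ p p′ q → p ≋ p′ → p *P q ≋ p′ *P q
  *P-congʳ p p′ q p≋p′ = coeffΣ⇒≋ (p *P q) (p′ *P q) λ m → begin
    coeffΣ (p *P q) m                            ≈⟨ coeffΣ-*P-⊖ p q m ⟩
    ∑ (λ { (b , f) → b * coeffAt p (m ⊖ f) }) q  ≈⟨ ∑-cong q (λ { (b , f) → *-congˡ (coeffAt-cong (m ⊖ f) p p′ p≋p′) }) ⟩
    ∑ (λ { (b , f) → b * coeffAt p′ (m ⊖ f) }) q ≈⟨ coeffΣ-*P-⊖ p′ q m ⟨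
    coeffΣ (p′ *P q) m                           ∎

  *P-comm : ∀ p q → p *P q ≋ q *P p
  *P-comm p q = coeffΣ⇒≋ (p *P q) (q *P p) λ m → begin
    coeffΣ (p *P q) m  ≈⟨ coeffΣ-*P p q m ⟩
    convolution p q m  ≈⟨ ∑-comm _ p q ⟩
    _                  ≈⟨ ∑-cong q (λ { (b , f) → ∑-cong p (λ { (a , e) →
                            select-cong (e ⊕ f ≟ₑ m) (f ⊕ e ≟ₑ m) (≡.trans (⊕-comm f e)) (≡.trans (⊕-comm e f))
                              (*-comm a b) }) }) ⟩
    convolution q p m  ≈⟨ coeffΣ-*P q p m ⟨
    coeffΣ (q *P p) m  ∎

  *P-assoc : ∀ p q r → (p *P q) *P r ≋ p *P (q *P r)
  *P-assoc p q r = coeffΣ⇒≋ ((p *P q) *P r) (p *P (q *P r)) λ m → begin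
    coeffΣ ((p *P q) *P r) m  ≈⟨ coeffΣ-*P (p *P q) r m ⟩
    convolution (p *P q) r m  ≈⟨ trans (∑-concatMap _ _ p) (∑-cong p λ t → reflexive (∑-map _ _ q)) ⟩
    _                         ≈⟨ ∑-cong p (λ { (a , e) → ∑-cong q (λ { (b , f) → ∑-cong r (λ { (d , g) →
                                   select-cong ((e ⊕ f) ⊕ g ≟ₑ m) (e ⊕ (f ⊕ g) ≟ₑ m)
                                     (≡.trans (≡.sym (⊕-assoc e f g))) (≡.trans (⊕-assoc e f g))
                                     (*-assoc a b d) }) }) }) ⟩
    _                         ≈⟨ ∑-cong p (λ t → sym (trans (∑-concatMap _ _ q) (∑-cong q λ u → reflexive (∑-map _ _ r)))) ⟩
    convolution p (q *P r) m  ≈⟨ coeffΣ-*P p (q *P r) m ⟨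
    coeffΣ (p *P (q *P r)) m  ∎

  *P-distribˡ : ∀ p q r → p *P (q +P r) ≋ p *P q +P p *P r
  *P-distribˡ p q r = coeffΣ⇒≋ (p *P (q +P r)) (p *P q +P p *P r) λ m → begin
    coeffΣ (p *P (q +P r)) m                ≈⟨ coeffΣ-*P p (q +P r) m ⟩
    convolution p (q +P r) m                ≈⟨ ∑-cong p (λ t → ∑-++ _ q r) ⟩
    _                                       ≈⟨ ∑-+ _ _ p ⟩
    convolution p q m + convolution p r m   ≈⟨ +-cong (coeffΣ-*P p q m) (coeffΣ-*P p r m) ⟨
    coeffΣ (p *P q) m + coeffΣ (p *P r) m   ≈⟨ coeffΣ-+P (p *P q) (p *P r) m ⟨
    coeffΣ (p *P q +P p *P r) m             ∎

  *P-identityˡ : ∀ p → 1P *P p ≋ p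
  *P-identityˡ p = coeffΣ⇒≋ (1P *P p) p λ m → begin
    coeffΣ (1P *P p) m  ≈⟨ coeffΣ-*P 1P p m ⟩
    convolution 1P p m  ≈⟨ +-identityʳ _ ⟩
    _                   ≈⟨ ∑-cong p (λ { (b , f) → select-cong (replicate n 0 ⊕ f ≟ₑ m) (f ≟ₑ m)
                             (≡.trans (≡.sym (⊕-identityˡ f))) (≡.trans (⊕-identityˡ f)) (*-identityˡ b) }) ⟩
    coeffΣ p m          ∎

  Pol-isCommutativeRing : IsCommutativeRing _≋_ _+P_ _*P_ -P_ 0P 1P
  Pol-isCommutativeRing = record
    { isRing = record
      { +-isAbelianGroup = record
        { isGroup = record
          { isMonoid = record
            { isSemigroup = record
              { isMagma = record
                { isEquivalence = ≋-isEquivalence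
                ; ∙-cong = λ {p} {p′} {q} {q′} → +P-cong p p′ q q′
                }
              ; assoc = λ p q r → ≡⇒≋ (++-assoc p q r)
              }
            ; identity = comm∧idˡ⇒id ≋-setoid {_+P_} +P-comm {0P} (λ p m → refl)
            }
          ; inverse = comm∧invˡ⇒inv ≋-setoid {_+P_} { -P_} {0P} +P-comm -P-inverseˡ
          ; ⁻¹-cong = λ {p} {q} → -P-cong p q
          }
        ; comm = +P-comm
        }
      ; *-cong = λ {p} {p′} {q} {q′} p≋p′ q≋q′ m →
          trans (*P-congʳ p p′ q p≋p′ m) (trans (*P-comm p′ q m) (trans (*P-congʳ q q′ p′ q≋q′ m) (*P-comm q′ p′ m)))
      ; *-assoc = *P-assoc
      ; *-identity = comm∧idˡ⇒id ≋-setoid {_*P_} *P-comm {1P} *P-identityˡ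
      ; distrib = comm∧distrˡ⇒distr ≋-setoid {_*P_} {_+P_} (λ {p} {p′} {q} {q′} → +P-cong p p′ q q′) *P-comm *P-distribˡ
      }
    ; *-comm = *P-comm
    }

  Pol-commutativeRing : CommutativeRing c ℓ
  Pol-commutativeRing = record { isCommutativeRing = Pol-isCommutativeRing }

  module _ (k : ℕ) where

    private
      sw : Exp → Exp
      sw = swapAt (k ∸ 1)

      sw-transpose : ∀ {e m} → sw e ≡ m → e ≡ sw m
      sw-transpose {e} ≡.refl = ≡.sym (swapAt-involutive (k ∸ 1) e)

    coeffΣ-s : ∀ p m → coeffΣ (s k p) m ≈ coeffΣ p (sw m)
    coeffΣ-s p m = trans (reflexive (∑-map _ _ p)) (∑-cong p λ { (a , e) →
      select-cong (sw e ≟ₑ m) (e ≟ₑ sw m) sw-transpose (λ e≡sw-m → ≡.sym (sw-transpose (≡.sym e≡sw-m))) refl })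

    s-cong : ∀ {p q} → p ≋ q → s k p ≋ s k q
    s-cong {p} {q} p≋q = coeffΣ⇒≋ (s k p) (s k q) λ m →
      trans (coeffΣ-s p m) (trans (≋⇒coeffΣ p q p≋q (sw m)) (sym (coeffΣ-s q m)))

    s-+ : ∀ p q → s k (p +P q) ≋ s k p +P s k q
    s-+ p q = ≡⇒≋ (map-++ _ p q)

    s-* : ∀ p q → s k (p *P q) ≋ s k p *P s k q
    s-* p q = coeffΣ⇒≋ (s k (p *P q)) (s k p *P s k q) λ m → begin
      coeffΣ (s k (p *P q)) m      ≈⟨ coeffΣ-s (p *P q) m ⟩
      coeffΣ (p *P q) (sw m)       ≈⟨ coeffΣ-*P p q (sw m) ⟩
      convolution p q (sw m)       ≈⟨ ∑-cong p (λ { (a , e) → ∑-cong q (λ { (b , f) →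
                                        select-cong (e ⊕ f ≟ₑ sw m) (sw e ⊕ sw f ≟ₑ m)
                                          (λ eq → ≡.trans (≡.sym (swapAt-⊕ (k ∸ 1) e f)) (≡.sym (sw-transpose (≡.sym eq))))
                                          (λ eq → sw-transpose (≡.trans (swapAt-⊕ (k ∸ 1) e f) eq)) refl }) }) ⟩
      _                            ≈⟨ ∑-cong p (λ t → reflexive (≡.sym (∑-map _ _ q))) ⟩
      _                            ≡⟨ ≡.sym (∑-map _ _ p) ⟩
      convolution (s k p) (s k q) m ≈⟨ coeffΣ-*P (s k p) (s k q) m ⟨
      coeffΣ (s k p *P s k q) m    ∎

    s-1 : s k (1P {n}) ≋ 1P
    s-1 = monomial-cong (swapAt-replicate (k ∸ 1) 0)

  s-x : ∀ k → 1 ≤ k → k < n → s k (x {n} k) ≋ x (suc k)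
  s-x (suc k) _ k<n = monomial-cong (swapAt-unitExp k 1 k<n)

  s-x-suc : ∀ k → 1 ≤ k → k < n → s k (x {n} (suc k)) ≋ x k
  s-x-suc (suc k) _ k<n = monomial-cong (swapAt-unitExp-suc k 1 k<n)

  s-x-far : ∀ i k → 1 ≤ k → k < i → s i (x {n} k) ≋ x k
  s-x-far (suc i) (suc k) _ (s≤s k<i) = monomial-cong (swapAt-unitExp-< i k 1 k<i)

  s-comm : ∀ k i (p : Pol n) → 1 ≤ k → suc (suc k) ≤ i → s i (s k p) ≋ s k (s i p)
  s-comm (suc k) (suc i) p _ (s≤s k+2≤i) = coeffΣ⇒≋ (s (suc i) (s (suc k) p)) (s (suc k) (s (suc i) p)) λ m →
    trans (coeffΣ-s (suc i) (s (suc k) p) m) (trans (coeffΣ-s (suc k) p _)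
      (trans (reflexive (≡.cong (coeffΣ p) (swapAt-comm k i m k+2≤i)))
      (sym (trans (coeffΣ-s (suc k) (s (suc i) p) m) (coeffΣ-s (suc i) p _)))))

  private
    module PolRing = CommutativeRing Pol-commutativeRing

  open import Algebra.Properties.Semiring.Exp PolRing.semiring public using (_^_)

  xPow≋^ : ∀ i a → xPow {n} i a ≋ x i ^ a
  xPow≋^ i zero    = monomial-cong (unitExp-zero (i ∸ 1))
  xPow≋^ i (suc a) = PolRing.trans {xPow i (suc a)} {x i *P xPow i a} {x i ^ suc a} xPow-suc
    (PolRing.*-congˡ {x i} {xPow i a} {x i ^ a} (xPow≋^ i a))
    where
    xPow-suc : xPow {n} i (suc a) ≋ x i *P xPow i a
    xPow-suc = coeffΣ⇒≋ (xPow i (suc a)) (x i *P xPow i a) λ m → sym (begin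
      coeffΣ (x i *P xPow i a) m   ≈⟨ coeffΣ-*P (x i) (xPow i a) m ⟩
      convolution (x i) (xPow i a) m ≈⟨ +-identityʳ _ ⟩
      _                            ≈⟨ +-congʳ (select-cong (unitExp (i ∸ 1) 1 ⊕ unitExp (i ∸ 1) a ≟ₑ m) (unitExp (i ∸ 1) (suc a) ≟ₑ m)
                                        (≡.trans (≡.sym (unitExp-⊕ (i ∸ 1) 1 a))) (≡.trans (unitExp-⊕ (i ∸ 1) 1 a)) (*-identityˡ 1#)) ⟩
      coeffΣ (xPow i (suc a)) m    ∎)

  coeffΣ-x*P : ∀ i h m → coeffΣ (x i *P h) m ≈ coeffAt h (m ⊖ unitExp (i ∸ 1) 1)
  coeffΣ-x*P i h m = begin
    coeffΣ (x i *P h) m                   ≈⟨ ≋⇒coeffΣ (x i *P h) (h *P x i) (*P-comm (x i) h) m ⟩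
    coeffΣ (h *P x i) m                   ≈⟨ coeffΣ-*P-⊖ h (x i) m ⟩
    1# * coeffAt h (m ⊖ unitExp (i ∸ 1) 1) + 0# ≈⟨ trans (+-identityʳ _) (*-identityˡ _) ⟩
    coeffAt h (m ⊖ unitExp (i ∸ 1) 1)     ∎

  x-cancel : ∀ k → 1 ≤ k → k < n → ∀ h → (x k -P x (suc k)) *P h ≋ 0P {n} → h ≋ 0P
  x-cancel (suc k) _ k<n h Dh≋0 d = trans (coeff≈coeffΣ h d) (vanish _ d ≡.refl)
    where
    u u′ : Exp
    u  = unitExp k 1
    u′ = unitExp (suc k) 1

    a b : Pol n
    a = x (suc k)
    b = x (suc (suc k))

    shift : ∀ m → coeffAt h (m ⊖ u) ≈ coeffAt h (m ⊖ u′)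
    shift m = x∙y⁻¹≈ε⇒x≈y +-group _ _ (begin
      coeffAt h (m ⊖ u) - coeffAt h (m ⊖ u′)     ≈⟨ +-cong (coeffΣ-x*P (suc k) h m) (-‿cong (coeffΣ-x*P (suc (suc k)) h m)) ⟨
      coeffΣ (a *P h) m - coeffΣ (b *P h) m       ≈⟨ +-congˡ (coeffΣ--P (b *P h) m) ⟨
      coeffΣ (a *P h) m + coeffΣ (-P (b *P h)) m  ≈⟨ coeffΣ-+P (a *P h) (-P (b *P h)) m ⟨
      coeffΣ (a *P h -P b *P h) m                 ≈⟨ ≋⇒coeffΣ ((a -P b) *P h) (a *P h -P b *P h) ([y-z]x≈yx-zx PolRing.ring h a b) m ⟨
      coeffΣ ((a -P b) *P h) m                    ≈⟨ ≋⇒coeffΣ ((a -P b) *P h) 0P Dh≋0 m ⟩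
      0#                                          ∎)

    -- By shift, the coefficient of h at d equals that at d + u − u′, which has one x_{k+2} fewer;
    -- iterating, the exponent of x_{k+2} runs out and the coefficient is that of no monomial.
    vanish : ∀ t d → entry (suc k) d ≡ t → coeffΣ h d ≈ 0#
    vanish t d d≡t = begin
      coeffΣ h d                 ≡⟨ ≡.cong (coeffAt h) (⊕-⊖ d u) ⟨
      coeffAt h ((d ⊕ u) ⊖ u)    ≈⟨ shift (d ⊕ u) ⟩
      coeffAt h ((d ⊕ u) ⊖ u′)   ≈⟨ descend t d≡t _ ≡.refl ⟩
      0#                         ∎
      where
      descend : ∀ t → entry (suc k) d ≡ t → ∀ r → (d ⊕ u) ⊖ u′ ≡ r → coeffAt h r ≈ 0#
      descend _        _   nothing   _  = refl
      descend zero     d≡0 (just d′) eq with () ← ≡.trans (entry-transfer k d d′ k<n (⊖-complete (d ⊕ u) u′ eq)) d≡0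
      descend (suc t′) d≡t (just d′) eq =
        vanish t′ d′ (suc-injective (≡.trans (entry-transfer k d d′ k<n (⊖-complete (d ⊕ u) u′ eq)) d≡t))

module _ {c ℓ} (P : CommutativeRing c ℓ) where

  open CommutativeRing P

  module DividedDifference
    (σ : Carrier → Carrier)
    (σ-cong : ∀ {a b} → a ≈ b → σ a ≈ σ b)
    (σ-+ : ∀ a b → σ (a + b) ≈ σ a + σ b)
    (σ-* : ∀ a b → σ (a * b) ≈ σ a * σ b)
    (D : Carrier)
    where

    open import Relation.Binary.Reasoning.Setoid setoid
    open import Algebra.Properties.Ring ring using (x[y-z]≈xy-xz; [y-z]x≈yx-zx; -‿+-comm)
    open import Algebra.Properties.Group +-group using (x∙y⁻¹≈ε⇒x≈y; x≈y⇒x∙y⁻¹≈ε)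
    open import Algebra.Properties.CommutativeSemigroup +-commutativeSemigroup using (interchange)
    open import Algebra.Properties.CommutativeSemigroup *-commutativeSemigroup using (x∙yz≈y∙xz)

    -- ∂ f = (f - σ f) / D, as a relation since D need not be invertible
    IsDD : Carrier → Carrier → Set ℓ
    IsDD f h = D * h ≈ f - σ f

    isDD-resp : ∀ {f f′ h h′} → f ≈ f′ → h ≈ h′ → IsDD f h → IsDD f′ h′
    isDD-resp {f} {f′} {h} {h′} f≈f′ h≈h′ dd = begin
      D * h′      ≈⟨ *-congˡ h≈h′ ⟨
      D * h       ≈⟨ dd ⟩
      f - σ f     ≈⟨ +-cong f≈f′ (-‿cong (σ-cong f≈f′)) ⟩
      f′ - σ f′   ∎

    isDD-+ : ∀ {f g h e} → IsDD f h → IsDD g e → IsDD (f + g) (h + e)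
    isDD-+ {f} {g} {h} {e} ddf ddg = begin
      D * (h + e)                  ≈⟨ distribˡ D h e ⟩
      D * h + D * e                ≈⟨ +-cong ddf ddg ⟩
      (f - σ f) + (g - σ g)        ≈⟨ interchange f (- σ f) g (- σ g) ⟩
      (f + g) + (- σ f + - σ g)    ≈⟨ +-congˡ (-‿+-comm (σ f) (σ g)) ⟩
      (f + g) - (σ f + σ g)        ≈⟨ +-congˡ (-‿cong (σ-+ f g)) ⟨
      (f + g) - σ (f + g)          ∎

    isDD-invariant : ∀ {f} → σ f ≈ f → IsDD f 0#
    isDD-invariant {f} σf≈f = begin
      D * 0#     ≈⟨ zeroʳ D ⟩
      0#         ≈⟨ x≈y⇒x∙y⁻¹≈ε (sym σf≈f) ⟨
      f - σ f    ∎

    invariant-isDD : ∀ {f} → IsDD f 0# → σ f ≈ f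
    invariant-isDD {f} dd = sym (x∙y⁻¹≈ε⇒x≈y f (σ f) (trans (sym dd) (zeroʳ D)))

    isDD-* : ∀ {u v a b} → IsDD u a → IsDD v b → IsDD (u * v) (a * v + σ u * b)
    isDD-* {u} {v} {a} {b} ddu ddv = begin
      D * (a * v + σ u * b)                 ≈⟨ distribˡ D (a * v) (σ u * b) ⟩
      D * (a * v) + D * (σ u * b)           ≈⟨ +-cong (sym (*-assoc D a v)) (x∙yz≈y∙xz D (σ u) b) ⟩
      (D * a) * v + σ u * (D * b)           ≈⟨ +-cong (*-congʳ ddu) (*-congˡ ddv) ⟩
      (u - σ u) * v + σ u * (v - σ v)       ≈⟨ +-cong ([y-z]x≈yx-zx v u (σ u)) (x[y-z]≈xy-xz (σ u) v (σ v)) ⟩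
      (u * v - σ u * v) + (σ u * v - σ u * σ v) ≈⟨ telescope (u * v) (σ u * v) (σ u * σ v) ⟩
      u * v - σ u * σ v                     ≈⟨ +-congˡ (-‿cong (σ-* u v)) ⟨
      u * v - σ (u * v)                     ∎
      where
      telescope : ∀ p q r → (p - q) + (q - r) ≈ p - r
      telescope p q r = begin
        (p - q) + (q - r)   ≈⟨ +-assoc p (- q) (q - r) ⟩
        p + (- q + (q - r)) ≈⟨ +-congˡ (+-assoc (- q) q (- r)) ⟨
        p + ((- q + q) - r) ≈⟨ +-congˡ (+-congʳ (-‿inverseˡ q)) ⟩
        p + (0# - r)        ≈⟨ +-congˡ (+-identityˡ (- r)) ⟩
        p - r               ∎

    isDD-unique : (∀ h → D * h ≈ 0# → h ≈ 0#) → ∀ {f h h′} → IsDD f h → IsDD f h′ → h ≈ h′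
    isDD-unique cancel {f} {h} {h′} dd dd′ = x∙y⁻¹≈ε⇒x≈y h h′ (cancel (h - h′) (begin
      D * (h - h′)        ≈⟨ x[y-z]≈xy-xz D h h′ ⟩
      D * h - D * h′      ≈⟨ +-cong dd (-‿cong dd′) ⟩
      (f - σ f) - (f - σ f) ≈⟨ -‿inverseʳ (f - σ f) ⟩
      0#                  ∎))

  module TranspositionAction (n : ℕ)
    (σ : ℕ → Carrier → Carrier)
    (x : ℕ → Carrier)
    (σ-cong : ∀ k {a b} → a ≈ b → σ k a ≈ σ k b)
    (σ-+ : ∀ k a b → σ k (a + b) ≈ σ k a + σ k b)
    (σ-* : ∀ k a b → σ k (a * b) ≈ σ k a * σ k b)
    (σ-1 : ∀ k → σ k 1# ≈ 1#)
    (σ-x : ∀ k → 1 ≤ k → k < n → σ k (x k) ≈ x (suc k))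
    (σ-x-suc : ∀ k → 1 ≤ k → k < n → σ k (x (suc k)) ≈ x k)
    (σ-x-far : ∀ i k → 1 ≤ k → k < i → σ i (x k) ≈ x k)
    (σ-comm : ∀ k i f → 1 ≤ k → suc (suc k) ≤ i → σ i (σ k f) ≈ σ k (σ i f))
    (cancel : ∀ k → 1 ≤ k → k < n → ∀ h → (x k - x (suc k)) * h ≈ 0# → h ≈ 0#)
    where

    open import Level using (_⊔_; Lift; lift)
    open import Data.Nat.Properties using (+-suc; ≤-trans; ≤-refl; ≤-reflexive; <-≤-trans; n≤1+n; m+n≤o⇒m≤o; m<m+n)
    open import Data.Product using (Σ; _×_; _,_)
    import Relation.Binary.PropositionalEquality as ≡
    open import Relation.Binary.Reasoning.Setoid setoid
    open import Algebra.Properties.Semiring.Exp semiring using (_^_)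
    open import Algebra.Properties.Ring ring using (x+x≈x⇒x≈0; +-inverseʳ-unique)
    open import Algebra.Properties.CommutativeSemigroup *-commutativeSemigroup using (x∙yz≈y∙xz)

    D : ℕ → Carrier
    D k = x k - x (suc k)

    x̄ : ℕ → Carrier
    x̄ k = 1# - x k

    module ∂ (k : ℕ) = DividedDifference (σ k) (σ-cong k) (σ-+ k) (σ-* k) (D k)

    σ-0 : ∀ k → σ k 0# ≈ 0#
    σ-0 k = x+x≈x⇒x≈0 (σ k 0#) (trans (sym (σ-+ k 0# 0#)) (σ-cong k (+-identityˡ 0#)))

    σ-neg : ∀ k a → σ k (- a) ≈ - σ k a
    σ-neg k a = +-inverseʳ-unique (σ k a) (σ k (- a))
      (trans (sym (σ-+ k a (- a))) (trans (σ-cong k (-‿inverseʳ a)) (σ-0 k)))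

    σ-sub : ∀ k a b → σ k (a - b) ≈ σ k a - σ k b
    σ-sub k a b = trans (σ-+ k a (- b)) (+-congˡ (σ-neg k b))

    σ-x̄-of : ∀ k {i a} → σ k (x i) ≈ a → σ k (x̄ i) ≈ 1# - a
    σ-x̄-of k {i} σxᵢ≈a = trans (σ-sub k 1# (x i)) (+-cong (σ-1 k) (-‿cong σxᵢ≈a))

    σ-x̄ : ∀ k → 1 ≤ k → k < n → σ k (x̄ k) ≈ x̄ (suc k)
    σ-x̄ k 1≤k k<n = σ-x̄-of k (σ-x k 1≤k k<n)

    σ-x̄-suc : ∀ k → 1 ≤ k → k < n → σ k (x̄ (suc k)) ≈ x̄ k
    σ-x̄-suc k 1≤k k<n = σ-x̄-of k (σ-x-suc k 1≤k k<n)

    Invariant : ℕ → Carrier → Set ℓ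
    Invariant i f = σ i f ≈ f

    InvariantOn : ℕ → ℕ → Carrier → Set ℓ
    InvariantOn k l f = ∀ i → k ≤ i → i < l → Invariant i f

    invariantOn-mono : ∀ {k k′ l l′ f} → k ≤ k′ → l′ ≤ l → InvariantOn k l f → InvariantOn k′ l′ f
    invariantOn-mono k≤k′ l′≤l inv i k′≤i i<l′ = inv i (≤-trans k≤k′ k′≤i) (<-≤-trans i<l′ l′≤l)

    invariantOn-* : ∀ {k l a b} → InvariantOn k l a → InvariantOn k l b → InvariantOn k l (a * b)
    invariantOn-* inva invb i k≤i i<l = trans (σ-* i _ _) (*-cong (inva i k≤i i<l) (invb i k≤i i<l))

    invariantOn-x : ∀ {j k l} → 1 ≤ j → j < k → InvariantOn k l (x j)
    invariantOn-x {j} 1≤j j<k i k≤i _ = σ-x-far i j 1≤j (<-≤-trans j<k k≤i)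

    invariantOn-x̄ : ∀ {j k l} → 1 ≤ j → j < k → InvariantOn k l (x̄ j)
    invariantOn-x̄ 1≤j j<k i k≤i i<l = σ-x̄-of i (invariantOn-x 1≤j j<k i k≤i i<l)

    invariantOn-^ : ∀ {j k l} c → 1 ≤ j → j < k → InvariantOn k l (x j ^ c)
    invariantOn-^ zero    1≤j j<k i _ _ = σ-1 i
    invariantOn-^ (suc c) 1≤j j<k     = invariantOn-* (invariantOn-x 1≤j j<k) (invariantOn-^ c 1≤j j<k)

    -- by uniqueness of ∂ₖ, since σᵢ commutes with σₖ and fixes D k
    invariantOn-∂ : ∀ {k l f h} → 1 ≤ k → k < n →
                    ∂.IsDD k f h → InvariantOn (suc (suc k)) l f → InvariantOn (suc (suc k)) l h
    invariantOn-∂ {k} {l} {f} {h} 1≤k k<n dd invf i k+2≤i i<l =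
      ∂.isDD-unique k (cancel k 1≤k k<n) dd′ dd
      where
      σD≈D : σ i (D k) ≈ D k
      σD≈D = trans (σ-sub i (x k) (x (suc k))) (
        +-cong (σ-x-far i k 1≤k (≤-trans (n≤1+n _) k+2≤i)) (-‿cong (σ-x-far i (suc k) (ℕ.s≤s ℕ.z≤n) k+2≤i)))
      σf≈f = invf i k+2≤i i<l
      dd′ : ∂.IsDD k f (σ i h)
      dd′ = begin
        D k * σ i h               ≈⟨ *-congʳ σD≈D ⟨
        σ i (D k) * σ i h         ≈⟨ σ-* i (D k) h ⟨
        σ i (D k * h)             ≈⟨ σ-cong i dd ⟩
        σ i (f - σ k f)           ≈⟨ σ-sub i f (σ k f) ⟩
        σ i f - σ i (σ k f)       ≈⟨ +-cong σf≈f (-‿cong (σ-comm k i f 1≤k k+2≤i)) ⟩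
        f - σ k (σ i f)           ≈⟨ +-congˡ (-‿cong (σ-cong k σf≈f)) ⟩
        f - σ k f                 ∎

    IsDDbar : ℕ → Carrier → Carrier → Set ℓ
    IsDDbar k f h = ∂.IsDD k (x̄ (suc k) * f) h

    IsPibar : ℕ → Carrier → Carrier → Set ℓ
    IsPibar k f h = ∂.IsDD k (x k * (x̄ (suc k) * f)) h

    isDDbar-resp : ∀ {k f f′ h h′} → f ≈ f′ → h ≈ h′ → IsDDbar k f h → IsDDbar k f′ h′
    isDDbar-resp {k} f≈f′ = ∂.isDD-resp k (*-congˡ f≈f′)

    isPibar⇒isDDbar : ∀ {k f h} → IsPibar k f h → IsDDbar k (x k * f) h
    isPibar⇒isDDbar {k} {f} = ∂.isDD-resp k (x∙yz≈y∙xz (x k) (x̄ (suc k)) f) refl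

    isDDbar-x : ∀ {k F H} → 1 ≤ k → k < n → IsDDbar k F H →
                IsDDbar k (x k * F) (x (suc k) * H + x̄ (suc k) * F)
    isDDbar-x {k} {F} {H} 1≤k k<n dd = ∂.isDD-resp k
      (x∙yz≈y∙xz (x k) (x̄ (suc k)) F)
      (trans (+-cong (*-identityˡ _) (*-congʳ (σ-x k 1≤k k<n))) (+-comm _ _))
      (∂.isDD-* k ddx dd)
      where
      ddx : ∂.IsDD k (x k) 1#
      ddx = trans (*-identityʳ (D k)) (+-congˡ (-‿cong (sym (σ-x k 1≤k k<n))))

    shiftError : ℕ → ℕ → Carrier → Carrier
    shiftError k zero    F = 0#
    shiftError k (suc c) F = x (suc k) * shiftError k c F + x̄ (suc k) * (x k ^ c * F)

    isDDbar-x^ : ∀ {k F H} c → 1 ≤ k → k < n → IsDDbar k F H →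
                 IsDDbar k (x k ^ c * F) (x (suc k) ^ c * H + shiftError k c F)
    isDDbar-x^ {k} {F} {H} zero 1≤k k<n dd =
      isDDbar-resp (sym (*-identityˡ F)) (sym (trans (+-identityʳ _) (*-identityˡ H))) dd
    isDDbar-x^ {k} {F} {H} (suc c) 1≤k k<n dd =
      isDDbar-resp (sym (*-assoc (x k) (x k ^ c) F)) regroup (isDDbar-x 1≤k k<n (isDDbar-x^ c 1≤k k<n dd))
      where
      y = x (suc k)
      E = shiftError k c F
      regroup : y * (y ^ c * H + E) + x̄ (suc k) * (x k ^ c * F) ≈ y ^ suc c * H + shiftError k (suc c) F
      regroup = begin
        y * (y ^ c * H + E) + x̄ (suc k) * (x k ^ c * F)     ≈⟨ +-congʳ (distribˡ y (y ^ c * H) E) ⟩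
        (y * (y ^ c * H) + y * E) + x̄ (suc k) * (x k ^ c * F) ≈⟨ +-assoc _ _ _ ⟩
        y * (y ^ c * H) + shiftError k (suc c) F            ≈⟨ +-congʳ (*-assoc y (y ^ c) H) ⟨
        y ^ suc c * H + shiftError k (suc c) F              ∎

    Chain : (ℕ → Carrier → Carrier → Set ℓ) → ℕ → ℕ → Carrier → Carrier → Set (c ⊔ ℓ)
    Chain Step k zero    f h = Lift c (f ≈ h)
    Chain Step k (suc m) f h = Σ Carrier λ p → Step k f p × Chain Step (suc k) m p h

    ChainBar ChainPi : ℕ → ℕ → Carrier → Carrier → Set (c ⊔ ℓ)
    ChainBar = Chain IsDDbar
    ChainPi  = Chain IsPibar

    chainBar-resp : ∀ {k} r {F F′ h h′} → F ≈ F′ → h ≈ h′ → ChainBar k r F h → ChainBar k r F′ h′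
    chainBar-resp zero    F≈F′ h≈h′ (lift F≈h)      = lift (trans (sym F≈F′) (trans F≈h h≈h′))
    chainBar-resp (suc r) F≈F′ h≈h′ (p , dd , rest) = p , isDDbar-resp F≈F′ refl dd , chainBar-resp r refl h≈h′ rest

    chainBar-+ : ∀ {k} r {F E h e} → ChainBar k r F h → ChainBar k r E e → ChainBar k r (F + E) (h + e)
    chainBar-+ zero    (lift F≈h)      (lift E≈e)        = lift (+-cong F≈h E≈e)
    chainBar-+ {k} (suc r) {F} {E} (p , dd , rest) (q , dd′ , rest′) =
      p + q , ∂.isDD-resp k (sym (distribˡ (x̄ (suc k)) F E)) refl (∂.isDD-+ k dd dd′) , chainBar-+ r rest rest′

    chainBar-0 : ∀ {k} r → ChainBar k r 0# 0#
    chainBar-0         zero    = lift refl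
    chainBar-0 {k} (suc r) = 0# , ∂.isDD-resp k (sym (zeroʳ _)) refl (∂.isDD-invariant k (σ-0 k)) , chainBar-0 r

    private
      +-suc-≤ : ∀ {k r} → k ℕ.+ suc r ≤ n → suc k ℕ.+ r ≤ n
      +-suc-≤ {k} {r} = ≡.subst (_≤ n) (+-suc k r)

      +-suc-< : ∀ {k r} → k ℕ.+ suc r ≤ n → k < n
      +-suc-< k+r+1≤n = m+n≤o⇒m≤o (suc _) (+-suc-≤ k+r+1≤n)

    chainBar-unique : ∀ {k} r {F h h′} → 1 ≤ k → k ℕ.+ r ≤ n → ChainBar k r F h → ChainBar k r F h′ → h ≈ h′
    chainBar-unique zero    1≤k k+r≤n (lift F≈h) (lift F≈h′) = trans (sym F≈h) F≈h′
    chainBar-unique {k} (suc r) 1≤k k+r≤n (p , dd , rest) (p′ , dd′ , rest′) =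
      chainBar-unique r (ℕ.s≤s ℕ.z≤n) (+-suc-≤ k+r≤n) rest (chainBar-resp r (sym p≈p′) refl rest′)
      where p≈p′ = ∂.isDD-unique k (cancel k 1≤k (+-suc-< k+r≤n)) dd dd′

    mutual
      chainBar-x^x̄ : ∀ k r c {S} → 1 ≤ k → k ℕ.+ r ≤ n → c < r → InvariantOn k (k ℕ.+ r) S →
                     ChainBar k r (x k ^ c * (x̄ k * S)) 0#
      chainBar-x^x̄ k (suc r) c {S} 1≤k k+r≤n (ℕ.s≤s c≤r) invS =
        _ , isDDbar-x^ c 1≤k k<n vanish ,
        chainBar-resp r (trans (*-identityˡ _) (sym (trans (+-congʳ (zeroʳ _)) (+-identityˡ _)))) refl
          (chainBar-shiftError k r c 0 1≤k (+-suc-≤ k+r≤n) c≤r invS′)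
        where
        k<n = +-suc-< k+r≤n
        invS′ : InvariantOn (suc k) (suc k ℕ.+ r) (x̄ k * S)
        invS′ = invariantOn-* (invariantOn-x̄ 1≤k ≤-refl) (invariantOn-mono (n≤1+n k) (≤-reflexive (≡.sym (+-suc k r))) invS)
        vanish : IsDDbar k (x̄ k * S) 0#
        vanish = ∂.isDD-invariant k (begin
          σ k (x̄ (suc k) * (x̄ k * S))              ≈⟨ σ-* k _ _ ⟩
          σ k (x̄ (suc k)) * σ k (x̄ k * S)          ≈⟨ *-cong (σ-x̄-suc k 1≤k k<n) (σ-* k _ _) ⟩
          x̄ k * (σ k (x̄ k) * σ k S)                ≈⟨ *-congˡ (*-cong (σ-x̄ k 1≤k k<n) (invS k ≤-refl (m<m+n k ℕ.z<s))) ⟩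
          x̄ k * (x̄ (suc k) * S)                    ≈⟨ x∙yz≈y∙xz (x̄ k) (x̄ (suc k)) S ⟩
          x̄ (suc k) * (x̄ k * S)                    ∎)

      chainBar-shiftError : ∀ k r a b {F} → 1 ≤ k → suc k ℕ.+ r ≤ n → b ℕ.+ a ≤ r →
                            InvariantOn (suc k) (suc k ℕ.+ r) F →
                            ChainBar (suc k) r (x (suc k) ^ b * shiftError k a F) 0#
      chainBar-shiftError k r zero    b 1≤k k+r≤n b+a≤r invF = chainBar-resp r (sym (zeroʳ _)) refl (chainBar-0 r)
      chainBar-shiftError k r (suc a) b {F} 1≤k k+r≤n b+a≤r invF =
        chainBar-resp r expand (+-identityʳ 0#) (chainBar-+ r
          (chainBar-shiftError k r a (suc b) 1≤k k+r≤n (≡.subst (_≤ r) (+-suc b a) b+a≤r) invF)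
          (chainBar-x^x̄ (suc k) r b (ℕ.s≤s ℕ.z≤n) k+r≤n (m+n≤o⇒m≤o (suc b) (≡.subst (_≤ r) (+-suc b a) b+a≤r)) invG))
        where
        y = x (suc k)
        E = shiftError k a F
        G = x k ^ a * F
        invG : InvariantOn (suc k) (suc k ℕ.+ r) G
        invG = invariantOn-* (invariantOn-^ a 1≤k ≤-refl) invF
        expand : y ^ suc b * E + y ^ b * (x̄ (suc k) * G) ≈ y ^ b * shiftError k (suc a) F
        expand = begin
          (y * y ^ b) * E + y ^ b * (x̄ (suc k) * G) ≈⟨ +-congʳ (trans (*-assoc y (y ^ b) E) (x∙yz≈y∙xz y (y ^ b) E)) ⟩
          y ^ b * (y * E) + y ^ b * (x̄ (suc k) * G) ≈⟨ distribˡ (y ^ b) (y * E) (x̄ (suc k) * G) ⟨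
          y ^ b * shiftError k (suc a) F            ∎

    chainPi⇒chainBar : ∀ j γ {g h} → 1 ≤ j → j ℕ.+ γ ≤ n → InvariantOn (suc j) (j ℕ.+ γ) g →
                       ChainPi j γ g h → ChainBar j γ (x j ^ γ * g) h
    chainPi⇒chainBar j zero    {g} 1≤j j+γ≤n invg (lift g≈h) = lift (trans (*-identityˡ g) g≈h)
    chainPi⇒chainBar j (suc γ) {g} {h} 1≤j j+γ≤n invg (p , pib , rest) =
      _ , first , chainBar-resp γ refl (+-identityʳ h) (chainBar-+ γ main error)
      where
      j<n = +-suc-< j+γ≤n
      invg′ : InvariantOn (suc j) (suc j ℕ.+ γ) g
      invg′ = invariantOn-mono ≤-refl (≤-reflexive (≡.sym (+-suc j γ))) invg
      invF : InvariantOn (suc j) (suc j ℕ.+ γ) (x j * g)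
      invF = invariantOn-* (invariantOn-x 1≤j ≤-refl) invg′
      invp : InvariantOn (suc (suc j)) (suc j ℕ.+ γ) p
      invp = invariantOn-∂ 1≤j j<n pib (invariantOn-* (invariantOn-x 1≤j (n≤1+n _))
               (invariantOn-* (invariantOn-x̄ (ℕ.s≤s ℕ.z≤n) ≤-refl) (invariantOn-mono (n≤1+n _) ≤-refl invg′)))
      first : IsDDbar j (x j ^ suc γ * g) (x (suc j) ^ γ * p + shiftError j γ (x j * g))
      first = isDDbar-resp (trans (x∙yz≈y∙xz (x j ^ γ) (x j) g) (sym (*-assoc (x j) (x j ^ γ) g))) refl
                (isDDbar-x^ γ 1≤j j<n (isPibar⇒isDDbar pib))
      main : ChainBar (suc j) γ (x (suc j) ^ γ * p) h
      main = chainPi⇒chainBar (suc j) γ (ℕ.s≤s ℕ.z≤n) (+-suc-≤ j+γ≤n) invp rest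
      error : ChainBar (suc j) γ (shiftError j γ (x j * g)) 0#
      error = chainBar-resp γ (*-identityˡ _) refl (chainBar-shiftError j γ γ 0 1≤j (+-suc-≤ j+γ≤n) ≤-refl invF)

    chainBar-x^≈chainPi : ∀ j γ {g h₁ h₂} → 1 ≤ j → j ℕ.+ γ ≤ n → InvariantOn (suc j) (j ℕ.+ γ) g →
                          ChainBar j γ (x j ^ γ * g) h₁ → ChainPi j γ g h₂ → h₁ ≈ h₂
    chainBar-x^≈chainPi j γ 1≤j j+γ≤n invg bar pi =
      chainBar-unique γ 1≤j j+γ≤n bar (chainPi⇒chainBar j γ 1≤j j+γ≤n invg pi)

module PolynomialAction {c ℓ} (R : CommutativeRing c ℓ) (n : ℕ) where
  open PolynomialRing R n
  open Poly R using (x; s)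

  open TranspositionAction Pol-commutativeRing n s x s-cong s-+ s-* s-1 s-x s-x-suc s-x-far s-comm x-cancel public

  fromChainBar : ∀ k m {f h} → Poly.ChainBar R k m f h → ChainBar k m f h
  fromChainBar k zero    f≋h             = f≋h
  fromChainBar k (suc m) (p , dd , rest) = p , dd , fromChainBar (suc k) m rest

  fromChainPi : ∀ k m {f h} → Poly.ChainPi R k m f h → ChainPi k m f h
  fromChainPi k zero    f≋h             = f≋h
  fromChainPi k (suc m) (p , dd , rest) = p , dd , fromChainPi (suc k) m rest

open import Data.Nat using (_+_)

lemma5p11 : ∀ {c ℓ} (R : CommutativeRing c ℓ) (n j γ : ℕ) → 1 ≤ j → 2 ≤ γ → j + γ ≤ n →
    (g : Poly.Pol R n) →
    (∀ i → suc j ≤ i → i < j + γ → Poly.IsDDbar R i g g) →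
    (∀ i → suc j ≤ i → i < j + γ → Poly.IsDD R i g (Poly.0P R)) →
    ∀ h₁ h₂ →
    Poly.ChainBar R j γ (Poly._*P_ R (Poly.xPow R j γ) g) h₁ →
    Poly.ChainPi R j γ g h₂ →
    Poly._≋_ R h₁ h₂
lemma5p11 R n j γ 1≤j _ j+γ≤n g _ ∂g≈0 h₁ h₂ bar pi =
  chainBar-x^≈chainPi j γ {g} {h₁} {h₂} 1≤j j+γ≤n (λ i j<i i<j+γ → ∂.invariant-isDD i {g} (∂g≈0 i j<i i<j+γ))
    (chainBar-resp γ {xPow j γ *P g} {x j ^ γ *P g} {h₁} {h₁} (*-congʳ {g} {xPow j γ} {x j ^ γ} (xPow≋^ j γ)) (refl {h₁})
      (fromChainBar j γ bar))
    (fromChainPi j γ pi)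
  where
  open PolynomialAction R n
  open PolynomialRing R n using (xPow≋^; Pol-commutativeRing; _^_)
  open CommutativeRing Pol-commutativeRing using (*-congʳ; refl)
  open Poly R using (xPow; x; _*P_)
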